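{- Let $\varsigma\in\mathcal{S}_p(v,0)$ be a prime substitution and $d\ge0$. Then: (a) for every level-$d$ minterm $\mu$ (in $v$ variables), $\mu\circ\varsigma$ is $\approx$ to a single level-$d$ minterm, and the resulting map $f_\varsigma(\mu)=\mu\circ\varsigma$ is a bijection of the set of level-$d$ minterms; (b) the map $f_\varsigma:\mathbf{E}[v,d]\to\mathbf{E}[v,d]$, $f_\varsigma(\varphi)=\varphi\circ\varsigma$, is a lattice automorphism.
   Context: Language: variables $p_1,p_2,\dots$, constants $0,1$, connectives $\neg,\vee,\wedge$, modal operator $\lozenge$. $\mathbf{E}$ is the smallest set of formulas containing all tautologies and closed under modus ponens, uniform substitution and RE (from $\varphi\leftrightarrow\psi$ infer $\lozenge\varphi\leftrightarrow\lozenge\psi$). $\varphi\approx\psi$ means $\vdash_{\mathbf{E}}\varphi\leftrightarrow\psi$. $\mathcal{F}(v,d)$: formulas in $p_1,\dots,p_v$ of $\lozenge$-depth $\le d$; $\mathbf{E}[v,d]=\mathcal{F}(v,d)/\approx$, a Boolean lattice. DCF minterms (fixed $v$): level-0 minterms are $\pm p_1\wedge\dots\wedge\pm p_v$; DCF formulas of $\mathcal{F}(v,0)$ are disjunctions of sets of distinct level-0 minterms; for $d\ge1$ the level-$d$ modal factors are $\lozenge\phi$ for every DCF formula $\phi$ of $\mathcal{F}(v,d-1)$, a level-$d$ minterm is a level-0 minterm conjoined with every level-$d$ modal factor, each plain or negated, and DCF formulas of $\mathcal{F}(v,d)$ are disjunctions of sets of distinct level-$d$ minterms. Every formula of $\mathcal{F}(v,d)$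 is $\approx$ to a unique DCF formula. Substitutions: a level-0 substitution is a tuple $\sigma=(\sigma_1,\dots,\sigma_v)$ of non-modal formulas in $p_1,\dots,p_v$ (up to $\approx$); $\varphi\circ\sigma$ replaces every $p_i$ in $\varphi$ (including inside $\lozenge$) by $\sigma_i$. Under composition $(\sigma\sigma')_i=\sigma_i(\sigma'_1,\dots,\sigma'_v)$ these form a monoid $\mathcal{S}(v,0)$; prime substitutions are its invertible elements, forming the group $\mathcal{S}_p(v,0)$. -}

module Defs where

open import Data.Nat using (ℕ; zero; suc; _+_; _*_; _^_; _<_; _≤_; _⊔_; _<?_)
open import Data.Bool using (Bool; true; false; not; _∧_; _∨_; if_then_else_)
open import Data.Fin using (Fin; toℕ; fromℕ<)
open import Data.Vec using (Vec; []; _∷_; map; _++_; allPairs; zipWith; toList; tabulate)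
open import Data.List as L using (List)
open import Data.Product using (Σ; _×_; _,_; proj₁; proj₂)
open import Data.Unit using (⊤)
open import Relation.Nullary using (yes; no)
open import Relation.Binary.PropositionalEquality using (_≡_)
open import Function.Definitions using (Congruent; Bijective)

-- Formulas.  Variable  var i  stands for  p_(i+1).

infixr 6 _⋀_
infixr 5 _⋁_

data Formula : Set where
  var  : ℕ → Formula
  𝟘 𝟙  : Formula
  ¬'_  : Formula → Formula
  _⋁_  : Formula → Formula → Formula
  _⋀_  : Formula → Formula → Formula
  ◇    : Formula → Formula

_⇒_ : Formula → Formula → Formula
φ ⇒ ψ = (¬' φ) ⋁ ψ

_⇔_ : Formula → Formula → Formula
φ ⇔ ψ = (φ ⇒ ψ) ⋀ (ψ ⇒ φ)

-- Tautologies: true under every Boolean valuation that treats the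
-- modal formulas  ◇ψ  as propositional atoms.

eval : (ℕ → Bool) → (Formula → Bool) → Formula → Bool
eval val w (var i)  = val i
eval val w 𝟘        = false
eval val w 𝟙        = true
eval val w (¬' φ)   = not (eval val w φ)
eval val w (φ ⋁ ψ)  = eval val w φ ∨ eval val w ψ
eval val w (φ ⋀ ψ)  = eval val w φ ∧ eval val w ψ
eval val w (◇ φ)    = w φ

Tautology : Formula → Set
Tautology φ = ∀ (val : ℕ → Bool) (w : Formula → Bool) → eval val w φ ≡ true

subst : (ℕ → Formula) → Formula → Formula
subst s (var i)  = s i
subst s 𝟘        = 𝟘
subst s 𝟙        = 𝟙
subst s (¬' φ)   = ¬' (subst s φ)
subst s (φ ⋁ ψ)  = subst s φ ⋁ subst s ψ
subst s (φ ⋀ ψ)  = subst s φ ⋀ subst s ψ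
subst s (◇ φ)    = ◇ (subst s φ)

data ⊢E : Formula → Set where
  taut : ∀ {φ} → Tautology φ → ⊢E φ
  mp   : ∀ {φ ψ} → ⊢E φ → ⊢E (φ ⇒ ψ) → ⊢E ψ
  usub : ∀ {φ} (s : ℕ → Formula) → ⊢E φ → ⊢E (subst s φ)
  re   : ∀ {φ ψ} → ⊢E (φ ⇔ ψ) → ⊢E (◇ φ ⇔ ◇ ψ)

infix 4 _≈_
_≈_ : Formula → Formula → Set
φ ≈ ψ = ⊢E (φ ⇔ ψ)

depth : Formula → ℕ
depth (var i)  = 0
depth 𝟘        = 0
depth 𝟙        = 0
depth (¬' φ)   = depth φ
depth (φ ⋁ ψ)  = depth φ ⊔ depth ψ
depth (φ ⋀ ψ)  = depth φ ⊔ depth ψ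
depth (◇ φ)    = suc (depth φ)

VarsBelow : ℕ → Formula → Set
VarsBelow v (var i)  = i < v
VarsBelow v 𝟘        = ⊤
VarsBelow v 𝟙        = ⊤
VarsBelow v (¬' φ)   = VarsBelow v φ
VarsBelow v (φ ⋁ ψ)  = VarsBelow v φ × VarsBelow v ψ
VarsBelow v (φ ⋀ ψ)  = VarsBelow v φ × VarsBelow v ψ
VarsBelow v (◇ φ)    = VarsBelow v φ

InF : ℕ → ℕ → Formula → Set
InF v d φ = VarsBelow v φ × depth φ ≤ d

-- Carrier of E[v,d] (taken modulo _≈_).
F : ℕ → ℕ → Set
F v d = Σ Formula (InF v d)

_≈F_ : ∀ {v d} → F v d → F v d → Set
x ≈F y = proj₁ x ≈ proj₁ y

Sub0 : ℕ → Set
Sub0 v = Σ (Fin v → Formula) (λ σ → ∀ i → InF v 0 (σ i))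

-- as a uniform substitution: p_(i+1) ↦ σ_(i+1) for i < v (other
-- variables are left unchanged; they do not occur in F(v,d)).
toSub : ∀ {v} → Sub0 v → ℕ → Formula
toSub {v} σ n with n <? v
... | yes n<v = proj₁ σ (fromℕ< n<v)
... | no  _   = var n

_∘ₛ_ : ∀ {v} → Formula → Sub0 v → Formula
φ ∘ₛ σ = subst (toSub σ) φ

-- identity of the monoid S(v,0): (p_1, …, p_v); composition
-- (σσ')_i = σ_i ∘ σ'.  Prime = invertible (up to ≈).
IsPrime : ∀ {v} → Sub0 v → Set
IsPrime {v} σ = Σ (Sub0 v) λ τ →
  (∀ (i : Fin v) → (proj₁ σ i ∘ₛ τ) ≈ var (toℕ i)) ×
  (∀ (i : Fin v) → (proj₁ τ i ∘ₛ σ) ≈ var (toℕ i))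

allVecs : (n : ℕ) → Vec (Vec Bool n) (2 ^ n)
allVecs zero    = [] ∷ []
allVecs (suc n) = map (true ∷_) (allVecs n) ++ (map (false ∷_) (allVecs n) ++ [])

bigAnd : List Formula → Formula
bigAnd L.[]            = 𝟙
bigAnd (x L.∷ L.[])    = x
bigAnd (x L.∷ y L.∷ r) = x ⋀ bigAnd (y L.∷ r)

bigOr : List Formula → Formula
bigOr L.[]            = 𝟘
bigOr (x L.∷ L.[])    = x
bigOr (x L.∷ y L.∷ r) = x ⋁ bigOr (y L.∷ r)

signed : Bool → Formula → Formula
signed true  φ = φ
signed false φ = ¬' φ

select : ∀ {n} → Vec Bool n → Vec Formula n → List Formula
select []          []       = L.[]
select (true ∷ b)  (x ∷ xs) = x L.∷ select b xs
select (false ∷ b) (_ ∷ xs) = select b xs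

module DCF (v : ℕ) where

  -- number of level-d modal factors
  nf : ℕ → ℕ
  card : ℕ → ℕ
  nf zero    = 0
  nf (suc d) = 2 ^ card d
  card d = 2 ^ v * 2 ^ nf d

  -- a level-d minterm is determined by the signs of the v variables and
  -- the signs of the nf d level-d modal factors
  Minterm : ℕ → Set
  Minterm d = Vec Bool v × Vec Bool (nf d)

  allMinterms : (d : ℕ) → Vec (Minterm d) (card d)
  allMinterms d = allPairs (allVecs v) (allVecs (nf d))

  lits : Vec Bool v → List Formula
  lits s = toList (zipWith signed s (tabulate (λ (i : Fin v) → var (toℕ i))))

  -- a DCF formula of level d is given by the set (characteristic vector
  -- w.r.t. the enumeration allMinterms d) of its minterms
  DCFset : ℕ → Set
  DCFset d = Vec Bool (card d)

  factors : (d : ℕ) → Vec Formula (nf d)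
  minterm : (d : ℕ) → Minterm d → Formula
  dcf     : (d : ℕ) → DCFset d → Formula

  factors zero    = []
  factors (suc d) = map (λ S → ◇ (dcf d S)) (allVecs (card d))

  minterm d (s , t) = bigAnd (lits s L.++ toList (zipWith signed t (factors d)))

  dcf d S = bigOr (select S (map (minterm d) (allMinterms d)))

record IsLatticeAut (v d : ℕ) (h : Formula → Formula) : Set where
  field
    closed     : ∀ φ → InF v d φ → InF v d (h φ)
  hF : F v d → F v d
  hF (φ , p) = h φ , closed φ p
  field
    congruent  : Congruent _≈F_ _≈F_ hF
    bijective  : Bijective _≈F_ _≈F_ hF
    pres-meet  : ∀ φ ψ → InF v d φ → InF v d ψ → h (φ ⋀ ψ) ≈ (h φ ⋀ h ψ)
    pres-join  : ∀ φ ψ → InF v d φ → InF v d ψ → h (φ ⋁ ψ) ≈ (h φ ⋁ h ψ)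

-- A formula of F(v,d) is determined up to ≈ by its truth table on the level-d minterms, taken in
-- a canonical neighbourhood model whose worlds are the minterms of all levels, the
-- neighbourhoods of a level-(k+1) minterm being given by its signs on the modal factors: E is
-- sound for it, every minterm holds exactly at its own world, and, by induction on φ using RE at ◇,
-- φ ≈ the DCF formula with the truth table of φ.
-- A level-0 substitution σ has a dual map σ* on level-d minterms with (σ* μ ⊨ φ) = (μ ⊨ φ ∘ σ).
-- If σ is prime with inverse τ, then σ* and τ* are mutually inverse, so μ ∘ σ has the truth table
-- of the single minterm τ* μ; this is (a) with f_σ = τ*. For (b), φ ↦ φ ∘ σ commutes with ⋀ and ⋁
-- syntactically and is inverted up to ≈ by φ ↦ φ ∘ τ.

module Submission where

open import Defs
open import Data.Bool using (Bool; true; false; not; _∧_; _∨_)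
open import Data.Bool.ListAction using (and; or)
open import Data.Bool.Properties using (⇔→≡; ¬-not; ∧-assoc; ∧-identityʳ; ∨-identityʳ)
open import Data.Empty using (⊥-elim)
open import Data.Fin using (Fin; toℕ; fromℕ<; _↑ˡ_; _↑ʳ_; splitAt; combine; remQuot)
  renaming (zero to fzero; suc to fsuc)
open import Data.Fin.Properties
  using (toℕ-fromℕ<; fromℕ<-toℕ; toℕ<n; splitAt⁻¹-↑ˡ; splitAt⁻¹-↑ʳ; combine-remQuot; 0≢1+n; suc-injective)
open import Data.List as List using ([]; _∷_)
import Data.List.Properties as List
open import Data.List.Relation.Unary.All using (All; []; _∷_)
open import Data.List.Relation.Unary.All.Properties using (++⁺)
open import Data.Nat using (ℕ; zero; suc; _+_; _*_; _<_; _≤_; _⊔_; _<?_; _^_; z≤n; s≤s)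
open import Data.Nat.Properties using (m⊔n≤o⇒m≤o; m⊔n≤o⇒n≤o; ⊔-lub; n≤0⇒n≡0)
open import Data.Product using (Σ; _×_; _,_; proj₁; proj₂)
open import Data.Sum using (inj₁; inj₂)
open import Data.Unit using (tt)
open import Data.Vec using (Vec; []; _∷_; map; lookup; tabulate; zipWith; toList; allPairs)
open import Data.Vec.Properties
  using (lookup-map; lookup∘tabulate; tabulate∘lookup; tabulate-cong; lookup-++ˡ; lookup-++ʳ; lookup-⊛*; map-cong)
open import Function using (_∘_; case_of_)
open import Function.Bundles using (mk⇔)
open import Function.Definitions using (Bijective; Inverseᵇ)
import Function.Consequences.Setoid as ConsequencesSetoid
import Function.Consequences.Propositional as Consequences≡
open import Level using (0ℓ)
open import Relation.Binary.Bundles using (Setoid)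
import Relation.Binary.Construct.On as On
import Relation.Binary.Reasoning.Setoid as SetoidReasoning
open import Relation.Binary.PropositionalEquality
  using (_≡_; _≢_; refl; sym; trans; cong; cong₂; module ≡-Reasoning)
  renaming (subst to ≡-subst)
open import Relation.Nullary using (yes; no)

private variable
  v d n : ℕ
  φ φ′ ψ ψ′ χ χ′ : Formula

iff-intro : ∀ a b → a ≡ b → (not a ∨ b) ∧ (not b ∨ a) ≡ true
iff-intro false .false refl = refl
iff-intro true  .true  refl = refl

iff-elim : ∀ a b → (not a ∨ b) ∧ (not b ∨ a) ≡ true → a ≡ b
iff-elim false false _ = refl
iff-elim true  true  _ = refl

imp-intro : ∀ a b → (a ≡ true → b ≡ true) → not a ∨ b ≡ true
imp-intro false _ _ = refl
imp-intro true  _ h = h refl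

imp-elim : ∀ {a b} → a ≡ true → not a ∨ b ≡ true → b ≡ true
imp-elim refl h = h

≈-by-taut₁ : φ ≈ ψ →
  (∀ val w → eval val w φ ≡ eval val w ψ → eval val w φ′ ≡ eval val w ψ′) → φ′ ≈ ψ′
≈-by-taut₁ {φ} {ψ} {φ′} {ψ′} p h = mp p (taut λ val w →
  let e = eval val w in
  imp-intro (e (φ ⇔ ψ)) (e (φ′ ⇔ ψ′)) λ t →
    iff-intro (e φ′) (e ψ′) (h val w (iff-elim (e φ) (e ψ) t)))

≈-by-taut₂ : φ ≈ ψ → φ′ ≈ ψ′ →
  (∀ val w → eval val w φ ≡ eval val w ψ → eval val w φ′ ≡ eval val w ψ′ →
             eval val w χ ≡ eval val w χ′) → χ ≈ χ′
≈-by-taut₂ {φ} {ψ} {φ′} {ψ′} {χ} {χ′} p q h = mp q (mp p (taut λ val w →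
  let e = eval val w in
  imp-intro (e (φ ⇔ ψ)) (e ((φ′ ⇔ ψ′) ⇒ (χ ⇔ χ′))) λ t →
  imp-intro (e (φ′ ⇔ ψ′)) (e (χ ⇔ χ′)) λ t′ →
    iff-intro (e χ) (e χ′) (h val w (iff-elim (e φ) (e ψ) t) (iff-elim (e φ′) (e ψ′) t′))))

≈-taut : (∀ val w → eval val w φ ≡ eval val w ψ) → φ ≈ ψ
≈-taut {φ} {ψ} h = taut λ val w → iff-intro (eval val w φ) (eval val w ψ) (h val w)

≈-refl : φ ≈ φ
≈-refl = ≈-taut λ _ _ → refl

≈-sym : φ ≈ ψ → ψ ≈ φ
≈-sym p = ≈-by-taut₁ p λ _ _ → sym

≈-trans : φ ≈ ψ → ψ ≈ χ → φ ≈ χ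
≈-trans p q = ≈-by-taut₂ p q λ _ _ → trans

≈-setoid : Setoid 0ℓ 0ℓ
≈-setoid = record
  { Carrier       = Formula
  ; _≈_           = _≈_
  ; isEquivalence = record { refl = ≈-refl ; sym = ≈-sym ; trans = ≈-trans }
  }

module ≈-Reasoning = SetoidReasoning ≈-setoid

¬'-cong : φ ≈ ψ → ¬' φ ≈ ¬' ψ
¬'-cong p = ≈-by-taut₁ p λ _ _ → cong not

⋁-cong : φ ≈ φ′ → ψ ≈ ψ′ → φ ⋁ ψ ≈ φ′ ⋁ ψ′
⋁-cong p q = ≈-by-taut₂ p q λ _ _ → cong₂ _∨_

⋀-cong : φ ≈ φ′ → ψ ≈ ψ′ → φ ⋀ ψ ≈ φ′ ⋀ ψ′
⋀-cong p q = ≈-by-taut₂ p q λ _ _ → cong₂ _∧_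

subst-subst : ∀ s t φ → subst t (subst s φ) ≡ subst (subst t ∘ s) φ
subst-subst s t (var i)  = refl
subst-subst s t 𝟘        = refl
subst-subst s t 𝟙        = refl
subst-subst s t (¬' φ)   = cong ¬'_ (subst-subst s t φ)
subst-subst s t (φ ⋁ ψ)  = cong₂ _⋁_ (subst-subst s t φ) (subst-subst s t ψ)
subst-subst s t (φ ⋀ ψ)  = cong₂ _⋀_ (subst-subst s t φ) (subst-subst s t ψ)
subst-subst s t (◇ φ)    = cong ◇ (subst-subst s t φ)

subst-var : ∀ φ → subst var φ ≡ φ
subst-var (var i)  = refl
subst-var 𝟘        = refl
subst-var 𝟙        = refl
subst-var (¬' φ)   = cong ¬'_ (subst-var φ)
subst-var (φ ⋁ ψ)  = cong₂ _⋁_ (subst-var φ) (subst-var ψ)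
subst-var (φ ⋀ ψ)  = cong₂ _⋀_ (subst-var φ) (subst-var ψ)
subst-var (◇ φ)    = cong ◇ (subst-var φ)

subst-cong : ∀ {s t} φ → VarsBelow v φ → (∀ n → n < v → s n ≈ t n) → subst s φ ≈ subst t φ
subst-cong (var n)  n<v      h = h n n<v
subst-cong 𝟘        _        h = ≈-refl
subst-cong 𝟙        _        h = ≈-refl
subst-cong (¬' φ)   p        h = ¬'-cong (subst-cong φ p h)
subst-cong (φ ⋁ ψ)  (p , q)  h = ⋁-cong (subst-cong φ p h) (subst-cong ψ q h)
subst-cong (φ ⋀ ψ)  (p , q)  h = ⋀-cong (subst-cong φ p h) (subst-cong ψ q h)
subst-cong (◇ φ)    p        h = re (subst-cong φ p h)

toSub-< : (σ : Sub0 v) (n<v : n < v) → toSub σ n ≡ proj₁ σ (fromℕ< n<v)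
toSub-< {v} {n} σ n<v with n <? v
... | yes _   = refl
... | no  n≮v = ⊥-elim (n≮v n<v)

infix 4 _⋅_≈id

_⋅_≈id : Sub0 v → Sub0 v → Set
σ ⋅ ρ ≈id = ∀ i → proj₁ σ i ∘ₛ ρ ≈ var (toℕ i)

∘ₛ-cancel : (σ ρ : Sub0 v) → σ ⋅ ρ ≈id → ∀ φ → VarsBelow v φ → (φ ∘ₛ σ) ∘ₛ ρ ≈ φ
∘ₛ-cancel {v} σ ρ σρ φ p = begin
  (φ ∘ₛ σ) ∘ₛ ρ                  ≡⟨ subst-subst (toSub σ) (toSub ρ) φ ⟩
  subst (λ n → toSub σ n ∘ₛ ρ) φ  ≈⟨ subst-cong φ p cancel ⟩
  subst var φ                     ≡⟨ subst-var φ ⟩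
  φ                               ∎
  where
  open ≈-Reasoning
  cancel : ∀ n → n < v → toSub σ n ∘ₛ ρ ≈ var n
  cancel n n<v = begin
    toSub σ n ∘ₛ ρ                ≡⟨ cong (_∘ₛ ρ) (toSub-< σ n<v) ⟩
    proj₁ σ (fromℕ< n<v) ∘ₛ ρ     ≈⟨ σρ (fromℕ< n<v) ⟩
    var (toℕ (fromℕ< n<v))         ≡⟨ cong var (toℕ-fromℕ< n<v) ⟩
    var n                          ∎

∘ₛ-transpose : (σ ρ : Sub0 v) → ρ ⋅ σ ≈id → ∀ φ → VarsBelow v φ → ψ ≈ φ ∘ₛ ρ → ψ ∘ₛ σ ≈ φ
∘ₛ-transpose σ ρ ρσ φ p q = ≈-trans (usub (toSub σ) q) (∘ₛ-cancel ρ σ ρσ φ p)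

VarsBelow-∘ₛ : (σ : Sub0 v) → ∀ φ → VarsBelow v φ → VarsBelow v (φ ∘ₛ σ)
VarsBelow-∘ₛ σ (var n)  n<v rewrite toSub-< σ n<v = proj₁ (proj₂ σ (fromℕ< n<v))
VarsBelow-∘ₛ σ 𝟘        _       = tt
VarsBelow-∘ₛ σ 𝟙        _       = tt
VarsBelow-∘ₛ σ (¬' φ)   p       = VarsBelow-∘ₛ σ φ p
VarsBelow-∘ₛ σ (φ ⋁ ψ)  (p , q) = VarsBelow-∘ₛ σ φ p , VarsBelow-∘ₛ σ ψ q
VarsBelow-∘ₛ σ (φ ⋀ ψ)  (p , q) = VarsBelow-∘ₛ σ φ p , VarsBelow-∘ₛ σ ψ q
VarsBelow-∘ₛ σ (◇ φ)    p       = VarsBelow-∘ₛ σ φ p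

depth-∘ₛ : (σ : Sub0 v) → ∀ φ → VarsBelow v φ → depth (φ ∘ₛ σ) ≡ depth φ
depth-∘ₛ σ (var n)  n<v rewrite toSub-< σ n<v = n≤0⇒n≡0 (proj₂ (proj₂ σ (fromℕ< n<v)))
depth-∘ₛ σ 𝟘        _       = refl
depth-∘ₛ σ 𝟙        _       = refl
depth-∘ₛ σ (¬' φ)   p       = depth-∘ₛ σ φ p
depth-∘ₛ σ (φ ⋁ ψ)  (p , q) = cong₂ _⊔_ (depth-∘ₛ σ φ p) (depth-∘ₛ σ ψ q)
depth-∘ₛ σ (φ ⋀ ψ)  (p , q) = cong₂ _⊔_ (depth-∘ₛ σ φ p) (depth-∘ₛ σ ψ q)
depth-∘ₛ σ (◇ φ)    p       = cong suc (depth-∘ₛ σ φ p)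

InF-∘ₛ : (σ : Sub0 v) → ∀ φ → InF v d φ → InF v d (φ ∘ₛ σ)
InF-∘ₛ {d = d} σ φ (p , q) = VarsBelow-∘ₛ σ φ p , ≡-subst (_≤ d) (sym (depth-∘ₛ σ φ p)) q

∘ₛ-isLatticeAut : (σ τ : Sub0 v) → σ ⋅ τ ≈id → τ ⋅ σ ≈id → IsLatticeAut v d (_∘ₛ σ)
∘ₛ-isLatticeAut {v} {d} σ τ στ τσ = record
  { closed    = InF-∘ₛ σ
  ; congruent = usub (toSub σ)
  ; bijective = Consequences.inverseᵇ⇒bijective {f = substitute} {f⁻¹ = unsubstitute} inverses
  ; pres-meet = λ _ _ _ _ → ≈-refl
  ; pres-join = λ _ _ _ _ → ≈-refl
  }
  where
  module Consequences = ConsequencesSetoid (On.setoid ≈-setoid proj₁) (On.setoid ≈-setoid proj₁)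
  unsubstitute : F v d → F v d
  unsubstitute (φ , p) = φ ∘ₛ τ , InF-∘ₛ τ φ p
  substitute : F v d → F v d
  substitute (φ , p) = φ ∘ₛ σ , InF-∘ₛ σ φ p
  inverses : Inverseᵇ (_≈F_ {v} {d}) _≈F_ substitute unsubstitute
  inverses = (λ {(φ , p)} → ∘ₛ-transpose σ τ τσ φ (proj₁ p))
           , (λ {(φ , p)} → ∘ₛ-transpose τ σ στ φ (proj₁ p))

rank : Vec Bool n → Fin (2 ^ n)
rank                []          = fzero
rank {n = suc n}    (true ∷ b)  = rank b ↑ˡ (2 ^ n + 0)
rank {n = suc n}    (false ∷ b) = 2 ^ n ↑ʳ (rank b ↑ˡ 0)

lookup-allVecs-↑ˡ : ∀ (i : Fin (2 ^ n)) →
  lookup (allVecs (suc n)) (i ↑ˡ (2 ^ n + 0)) ≡ true ∷ lookup (allVecs n) i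
lookup-allVecs-↑ˡ {n} i =
  trans (lookup-++ˡ (map (true ∷_) (allVecs n)) _ i) (lookup-map i (true ∷_) (allVecs n))

lookup-allVecs-↑ʳ : ∀ (i : Fin (2 ^ n)) →
  lookup (allVecs (suc n)) (2 ^ n ↑ʳ (i ↑ˡ 0)) ≡ false ∷ lookup (allVecs n) i
lookup-allVecs-↑ʳ {n} i =
  trans (lookup-++ʳ (map (true ∷_) (allVecs n)) _ (i ↑ˡ 0))
    (trans (lookup-++ˡ (map (false ∷_) (allVecs n)) [] i) (lookup-map i (false ∷_) (allVecs n)))

lookup-rank : ∀ (b : Vec Bool n) → lookup (allVecs n) (rank b) ≡ b
lookup-rank         []          = refl
lookup-rank {suc n} (true ∷ b)  = trans (lookup-allVecs-↑ˡ {n} (rank b)) (cong (true ∷_) (lookup-rank b))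
lookup-rank {suc n} (false ∷ b) = trans (lookup-allVecs-↑ʳ {n} (rank b)) (cong (false ∷_) (lookup-rank b))

data Half (n : ℕ) : Fin (2 ^ suc n) → Set where
  upper : (i : Fin (2 ^ n)) → Half n (i ↑ˡ (2 ^ n + 0))
  lower : (i : Fin (2 ^ n)) → Half n (2 ^ n ↑ʳ (i ↑ˡ 0))

half : ∀ (j : Fin (2 ^ suc n)) → Half n j
half {n} j with splitAt (2 ^ n) j in eq
... | inj₁ i = ≡-subst (Half n) (splitAt⁻¹-↑ˡ eq) (upper i)
... | inj₂ k with splitAt (2 ^ n) {0} k in eq′
...   | inj₁ i = ≡-subst (Half n) (trans (cong (2 ^ n ↑ʳ_) (splitAt⁻¹-↑ˡ eq′)) (splitAt⁻¹-↑ʳ eq)) (lower i)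

rank-lookup : ∀ (j : Fin (2 ^ n)) → rank (lookup (allVecs n) j) ≡ j
rank-lookup {zero}  fzero = refl
rank-lookup {suc n} j with half {n} j
... | upper i = trans (cong rank (lookup-allVecs-↑ˡ {n} i)) (cong (_↑ˡ (2 ^ n + 0)) (rank-lookup {n} i))
... | lower i = trans (cong rank (lookup-allVecs-↑ʳ {n} i)) (cong (λ k → 2 ^ n ↑ʳ (k ↑ˡ 0)) (rank-lookup {n} i))

lookup-allPairs : ∀ {A B : Set} {m n} (xs : Vec A m) (ys : Vec B n) i j →
  lookup (allPairs xs ys) (combine i j) ≡ (lookup xs i , lookup ys j)
lookup-allPairs xs ys i j =
  trans (lookup-⊛* (map _,_ xs) ys i j) (cong (λ f → f (lookup ys j)) (lookup-map i _,_ xs))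

Signs : ℕ → ℕ → Set
Signs m n = Vec Bool m × Vec Bool n

rank² : ∀ {m} → Signs m n → Fin (2 ^ m * 2 ^ n)
rank² (s , t) = combine (rank s) (rank t)

lookup-rank² : ∀ {m} (st : Signs m n) → lookup (allPairs (allVecs m) (allVecs n)) (rank² st) ≡ st
lookup-rank² {n} {m} (s , t) =
  trans (lookup-allPairs (allVecs m) (allVecs n) (rank s) (rank t)) (cong₂ _,_ (lookup-rank s) (lookup-rank t))

rank²-lookup : ∀ {m} (i : Fin (2 ^ m * 2 ^ n)) → rank² (lookup (allPairs (allVecs m) (allVecs n)) i) ≡ i
rank²-lookup {n} {m} i =
  ≡-subst (λ j → rank² (lookup (allPairs (allVecs m) (allVecs n)) j) ≡ j) (combine-remQuot {2 ^ m} (2 ^ n) i)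
    (atCombine (remQuot {2 ^ m} (2 ^ n) i))
  where
  atCombine : ∀ ((a , b) : Fin (2 ^ m) × Fin (2 ^ n)) →
    rank² (lookup (allPairs (allVecs m) (allVecs n)) (combine a b)) ≡ combine a b
  atCombine (a , b) rewrite lookup-allPairs (allVecs m) (allVecs n) a b =
    cong₂ combine (rank-lookup {m} a) (rank-lookup {n} b)

lookup-ext : ∀ {A : Set} {xs ys : Vec A n} → (∀ i → lookup xs i ≡ lookup ys i) → xs ≡ ys
lookup-ext {xs = xs} {ys} h = trans (sym (tabulate∘lookup xs)) (trans (tabulate-cong h) (tabulate∘lookup ys))

infix 7 _=ᵇ_ _=ᵛ_

-- Chosen so that, for each b, eval val w (signed b φ) reduces to b =ᵇ eval val w φ.
_=ᵇ_ : Bool → Bool → Bool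
true  =ᵇ b = b
false =ᵇ b = not b

_=ᵛ_ : Vec Bool n → Vec Bool n → Bool
[]       =ᵛ []       = true
(a ∷ as) =ᵛ (b ∷ bs) = a =ᵇ b ∧ as =ᵛ bs

=ᵛ-refl : ∀ (as : Vec Bool n) → as =ᵛ as ≡ true
=ᵛ-refl []          = refl
=ᵛ-refl (true ∷ as) = =ᵛ-refl as
=ᵛ-refl (false ∷ as) = =ᵛ-refl as

=ᵛ⇒≡ : ∀ (as bs : Vec Bool n) → as =ᵛ bs ≡ true → as ≡ bs
=ᵛ⇒≡ []           []           _ = refl
=ᵛ⇒≡ (true ∷ as)  (true ∷ bs)  e = cong (true ∷_) (=ᵛ⇒≡ as bs e)
=ᵛ⇒≡ (false ∷ as) (false ∷ bs) e = cong (false ∷_) (=ᵛ⇒≡ as bs e)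

infix 7 _=ˢ_

_=ˢ_ : ∀ {m} → Signs m n → Signs m n → Bool
(s , t) =ˢ (s′ , t′) = s =ᵛ s′ ∧ t =ᵛ t′

=ˢ-refl : ∀ {m} (st : Signs m n) → st =ˢ st ≡ true
=ˢ-refl (s , t) rewrite =ᵛ-refl s = =ᵛ-refl t

=ˢ⇒≡ : ∀ {m} (st st′ : Signs m n) → st =ˢ st′ ≡ true → st ≡ st′
=ˢ⇒≡ (s , t) (s′ , t′) e with s =ᵛ s′ in es
... | true  = cong₂ _,_ (=ᵛ⇒≡ s s′ es) (=ᵛ⇒≡ t t′ e)
... | false = case e of λ ()

=ˢ-transpose : ∀ {m} {f g : Signs m n → Signs m n} → (∀ x → f (g x) ≡ x) → (∀ x → g (f x) ≡ x) →
  ∀ x y → x =ˢ f y ≡ g x =ˢ y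
=ˢ-transpose {f = f} {g} fg gf x y = ⇔→≡ (mk⇔ to from)
  where
  to : x =ˢ f y ≡ true → g x =ˢ y ≡ true
  to e rewrite =ˢ⇒≡ x (f y) e = trans (cong (_=ˢ y) (gf y)) (=ˢ-refl y)
  from : g x =ˢ y ≡ true → x =ˢ f y ≡ true
  from e rewrite sym (=ˢ⇒≡ (g x) y e) = trans (cong (x =ˢ_) (fg x)) (=ˢ-refl x)

and-++ : ∀ xs ys → and (xs List.++ ys) ≡ and xs ∧ and ys
and-++ []       ys = refl
and-++ (x ∷ xs) ys = trans (cong (x ∧_) (and-++ xs ys)) (sym (∧-assoc x _ _))

eval-bigAnd : ∀ val w L → eval val w (bigAnd L) ≡ and (List.map (eval val w) L)
eval-bigAnd val w []          = refl
eval-bigAnd val w (φ ∷ [])    = sym (∧-identityʳ _)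
eval-bigAnd val w (φ ∷ ψ ∷ L) = cong (eval val w φ ∧_) (eval-bigAnd val w (ψ ∷ L))

eval-bigOr : ∀ val w L → eval val w (bigOr L) ≡ or (List.map (eval val w) L)
eval-bigOr val w []          = refl
eval-bigOr val w (φ ∷ [])    = sym (∨-identityʳ _)
eval-bigOr val w (φ ∷ ψ ∷ L) = cong (eval val w φ ∨_) (eval-bigOr val w (ψ ∷ L))

eval-signed : ∀ val w (s : Vec Bool n) (φs : Vec Formula n) →
  and (List.map (eval val w) (toList (zipWith signed s φs))) ≡ s =ᵛ map (eval val w) φs
eval-signed val w []          []       = refl
eval-signed val w (true ∷ s)  (φ ∷ φs) = cong (eval val w φ ∧_) (eval-signed val w s φs)
eval-signed val w (false ∷ s) (φ ∷ φs) = cong (not (eval val w φ) ∧_) (eval-signed val w s φs)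

or-select-none : ∀ (f : Formula → Bool) (S : Vec Bool n) φs →
  (∀ i → f (lookup φs i) ≢ true) → or (List.map f (select S φs)) ≡ false
or-select-none f []          []       h = refl
or-select-none f (true ∷ S)  (φ ∷ φs) h rewrite ¬-not (h fzero) = or-select-none f S φs (h ∘ fsuc)
or-select-none f (false ∷ S) (φ ∷ φs) h = or-select-none f S φs (h ∘ fsuc)

or-select-unique : ∀ (f : Formula → Bool) (S : Vec Bool n) φs r →
  (∀ i → f (lookup φs i) ≡ true → i ≡ r) → f (lookup φs r) ≡ true →
  or (List.map f (select S φs)) ≡ lookup S r
or-select-unique f (true ∷ S)  (φ ∷ φs) fzero    h fr rewrite fr = refl
or-select-unique f (false ∷ S) (φ ∷ φs) fzero    h fr =
  or-select-none f S φs λ i e → 0≢1+n (sym (h (fsuc i) e))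
or-select-unique f (s ∷ S)     (φ ∷ φs) (fsuc r) h fr =
  trans (skip s) (or-select-unique f S φs r (λ i e → suc-injective (h (fsuc i) e)) fr)
  where
  skip : ∀ s → or (List.map f (select (s ∷ S) (φ ∷ φs))) ≡ or (List.map f (select S φs))
  skip true  rewrite ¬-not {f φ} (0≢1+n ∘ h fzero) = refl
  skip false = refl

InF-⋀ : ∀ φ ψ → InF v d φ → InF v d ψ → InF v d (φ ⋀ ψ)
InF-⋀ _ _ (p , q) (p′ , q′) = (p , p′) , ⊔-lub q q′

InF-⋁ : ∀ φ ψ → InF v d φ → InF v d ψ → InF v d (φ ⋁ ψ)
InF-⋁ _ _ (p , q) (p′ , q′) = (p , p′) , ⊔-lub q q′

InF-⋀⁻ : ∀ φ ψ → InF v d (φ ⋀ ψ) → InF v d φ × InF v d ψ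
InF-⋀⁻ φ ψ ((p , p′) , q) = (p , m⊔n≤o⇒m≤o (depth φ) (depth ψ) q) , (p′ , m⊔n≤o⇒n≤o (depth φ) (depth ψ) q)

InF-⋁⁻ : ∀ φ ψ → InF v d (φ ⋁ ψ) → InF v d φ × InF v d ψ
InF-⋁⁻ φ ψ ((p , p′) , q) = (p , m⊔n≤o⇒m≤o (depth φ) (depth ψ) q) , (p′ , m⊔n≤o⇒n≤o (depth φ) (depth ψ) q)

InF-bigAnd : ∀ {L} → All (InF v d) L → InF v d (bigAnd L)
InF-bigAnd []                = tt , z≤n
InF-bigAnd (p ∷ [])          = p
InF-bigAnd {L = φ ∷ L@(_ ∷ _)} (p ∷ ps) = InF-⋀ φ (bigAnd L) p (InF-bigAnd ps)

InF-bigOr : ∀ {L} → All (InF v d) L → InF v d (bigOr L)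
InF-bigOr []                = tt , z≤n
InF-bigOr (p ∷ [])          = p
InF-bigOr {L = φ ∷ L@(_ ∷ _)} (p ∷ ps) = InF-⋁ φ (bigOr L) p (InF-bigOr ps)

All-signed : ∀ (s : Vec Bool n) φs → (∀ i → InF v d (lookup φs i)) →
  All (InF v d) (toList (zipWith signed s φs))
All-signed []          []       h = []
All-signed (true ∷ s)  (φ ∷ φs) h = h fzero ∷ All-signed s φs (h ∘ fsuc)
All-signed (false ∷ s) (φ ∷ φs) h = h fzero ∷ All-signed s φs (h ∘ fsuc)

All-select : ∀ (S : Vec Bool n) φs → (∀ i → InF v d (lookup φs i)) → All (InF v d) (select S φs)
All-select []          []       h = []
All-select (true ∷ S)  (φ ∷ φs) h = h fzero ∷ All-select S φs (h ∘ fsuc)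
All-select (false ∷ S) (φ ∷ φs) h = All-select S φs (h ∘ fsuc)

-- Disjunctive canonical forms

module NormalForms (v : ℕ) where
  open DCF v

  variables : Vec Formula v
  variables = tabulate (λ (i : Fin v) → var (toℕ i))

  lookup-variables : ∀ i → lookup variables i ≡ var (toℕ i)
  lookup-variables = lookup∘tabulate (λ (i : Fin v) → var (toℕ i))

  lookup-factors-lookup : ∀ k j → lookup (factors (suc k)) j ≡ ◇ (dcf k (lookup (allVecs (card k)) j))
  lookup-factors-lookup k j = lookup-map j (λ S → ◇ (dcf k S)) (allVecs (card k))

  lookup-factors-rank : ∀ k (S : Vec Bool (card k)) → lookup (factors (suc k)) (rank S) ≡ ◇ (dcf k S)
  lookup-factors-rank k S = trans (lookup-factors-lookup k (rank S)) (cong (◇ ∘ dcf k) (lookup-rank S))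

  mutual
    InF-minterm : ∀ d μ → InF v d (minterm d μ)
    InF-minterm d (s , t) =
      InF-bigAnd (++⁺ (All-signed s variables InF-variable) (All-signed t (factors d) (InF-factor d)))
      where
      InF-variable : ∀ i → InF v d (lookup variables i)
      InF-variable i rewrite lookup-variables i = toℕ<n i , z≤n

    InF-factor : ∀ d i → InF v d (lookup (factors d) i)
    InF-factor (suc k) j rewrite lookup-factors-lookup k j =
      let p , q = InF-dcf k (lookup (allVecs (card k)) j) in p , s≤s q

    InF-dcf : ∀ d S → InF v d (dcf d S)
    InF-dcf d S = InF-bigOr (All-select S _ InF-lookup)
      where
      InF-lookup : ∀ i → InF v d (lookup (map (minterm d) (allMinterms d)) i)
      InF-lookup i rewrite lookup-map i (minterm d) (allMinterms d) = InF-minterm d (lookup (allMinterms d) i)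

  mintermOf : ∀ d → (ℕ → Bool) → (Formula → Bool) → Minterm d
  mintermOf d val w = map (eval val w) variables , map (eval val w) (factors d)

  eval-minterm : ∀ d ν val w → eval val w (minterm d ν) ≡ ν =ˢ mintermOf d val w
  eval-minterm d (s , t) val w = begin
    eval val w (bigAnd (lits s List.++ ts))
      ≡⟨ eval-bigAnd val w (lits s List.++ ts) ⟩
    and (List.map (eval val w) (lits s List.++ ts))
      ≡⟨ cong and (List.map-++ (eval val w) (lits s) ts) ⟩
    and (List.map (eval val w) (lits s) List.++ List.map (eval val w) ts)
      ≡⟨ and-++ (List.map (eval val w) (lits s)) _ ⟩
    and (List.map (eval val w) (lits s)) ∧ and (List.map (eval val w) ts)
      ≡⟨ cong₂ _∧_ (eval-signed val w s variables) (eval-signed val w t (factors d)) ⟩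
    (s , t) =ˢ mintermOf d val w ∎
    where
    open ≡-Reasoning
    ts = toList (zipWith signed t (factors d))

  eval-dcf : ∀ d S val w → eval val w (dcf d S) ≡ lookup S (rank² (mintermOf d val w))
  eval-dcf d S val w =
    trans (eval-bigOr val w (select S minterms))
      (or-select-unique (eval val w) S minterms (rank² μ) unique holds)
    where
    minterms = map (minterm d) (allMinterms d)
    μ = mintermOf d val w
    eval-lookup : ∀ i → eval val w (lookup minterms i) ≡ lookup (allMinterms d) i =ˢ μ
    eval-lookup i rewrite lookup-map i (minterm d) (allMinterms d) =
      eval-minterm d (lookup (allMinterms d) i) val w
    unique : ∀ i → eval val w (lookup minterms i) ≡ true → i ≡ rank² μ
    unique i e = trans (sym (rank²-lookup {nf d} {v} i))
      (cong rank² (=ˢ⇒≡ (lookup (allMinterms d) i) μ (trans (sym (eval-lookup i)) e)))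
    holds : eval val w (lookup minterms (rank² μ)) ≡ true
    holds = trans (eval-lookup (rank² μ)) (trans (cong (_=ˢ μ) (lookup-rank² μ)) (=ˢ-refl μ))

  -- The canonical neighbourhood model

  -- Variables outside p_1, …, p_v are false; they do not occur in F(v,d).
  valuation : Vec Bool v → ℕ → Bool
  valuation s n with n <? v
  ... | yes n<v = lookup s (fromℕ< n<v)
  ... | no  _   = false

  valuation-< : ∀ s (n<v : n < v) → valuation s n ≡ lookup s (fromℕ< n<v)
  valuation-< {n} s n<v with n <? v
  ... | yes _   = refl
  ... | no  n≮v = ⊥-elim (n≮v n<v)

  valuation-toℕ : ∀ s (i : Fin v) → valuation s (toℕ i) ≡ lookup s i
  valuation-toℕ s i = trans (valuation-< s (toℕ<n i)) (cong (lookup s) (fromℕ<-toℕ i (toℕ<n i)))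

  World : Set
  World = Σ ℕ Minterm

  -- The neighbourhoods of a level-(k+1) minterm are the truth sets of the level-k DCF formulas δ
  -- for which it asserts ◇ δ; level-0 minterms have none.
  neighbourhood : World → (World → Bool) → Bool
  neighbourhood (zero  , _)     X = false
  neighbourhood (suc k , s , t) X = lookup t (rank (map (λ μ → X (k , μ)) (allMinterms k)))

  truth : (World → ℕ → Bool) → World → Formula → Bool
  truth V x (var n)  = V x n
  truth V x 𝟘        = false
  truth V x 𝟙        = true
  truth V x (¬' φ)   = not (truth V x φ)
  truth V x (φ ⋁ ψ)  = truth V x φ ∨ truth V x ψ
  truth V x (φ ⋀ ψ)  = truth V x φ ∧ truth V x ψ
  truth V x (◇ φ)    = neighbourhood x (λ y → truth V y φ)

  neighbourhood-cong : ∀ x {X Y} → (∀ y → X y ≡ Y y) → neighbourhood x X ≡ neighbourhood x Y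
  neighbourhood-cong (zero  , _)     h = refl
  neighbourhood-cong (suc k , s , t) h = cong (lookup t ∘ rank) (map-cong (λ μ → h (k , μ)) (allMinterms k))

  truth-eval : ∀ V x φ → truth V x φ ≡ eval (V x) (λ ψ → neighbourhood x (λ y → truth V y ψ)) φ
  truth-eval V x (var n)  = refl
  truth-eval V x 𝟘        = refl
  truth-eval V x 𝟙        = refl
  truth-eval V x (¬' φ)   = cong not (truth-eval V x φ)
  truth-eval V x (φ ⋁ ψ)  = cong₂ _∨_ (truth-eval V x φ) (truth-eval V x ψ)
  truth-eval V x (φ ⋀ ψ)  = cong₂ _∧_ (truth-eval V x φ) (truth-eval V x ψ)
  truth-eval V x (◇ φ)    = refl

  truth-subst : ∀ V s x φ → truth V x (subst s φ) ≡ truth (λ y n → truth V y (s n)) x φ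
  truth-subst V s x (var n)  = refl
  truth-subst V s x 𝟘        = refl
  truth-subst V s x 𝟙        = refl
  truth-subst V s x (¬' φ)   = cong not (truth-subst V s x φ)
  truth-subst V s x (φ ⋁ ψ)  = cong₂ _∨_ (truth-subst V s x φ) (truth-subst V s x ψ)
  truth-subst V s x (φ ⋀ ψ)  = cong₂ _∧_ (truth-subst V s x φ) (truth-subst V s x ψ)
  truth-subst V s x (◇ φ)    = neighbourhood-cong x λ y → truth-subst V s y φ

  truth-sound : ⊢E φ → ∀ V x → truth V x φ ≡ true
  truth-sound {φ} (taut t)       V x = trans (truth-eval V x φ) (t _ _)
  truth-sound     (mp p q)       V x = imp-elim (truth-sound p V x) (truth-sound q V x)
  truth-sound     (usub {φ} s p) V x = trans (truth-subst V s x φ) (truth-sound p _ x)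
  truth-sound     (re {φ} {ψ} p) V x = iff-intro _ _ (neighbourhood-cong x λ y →
    iff-elim (truth V y φ) (truth V y ψ) (truth-sound p V y))

  truth-cong : φ ≈ ψ → ∀ V x → truth V x φ ≡ truth V x ψ
  truth-cong {φ} {ψ} p V x = iff-elim (truth V x φ) (truth V x ψ) (truth-sound p V x)

  canonical : World → ℕ → Bool
  canonical (_ , s , _) = valuation s

  infix 5 _⊨_

  _⊨_ : World → Formula → Bool
  x ⊨ φ = truth canonical x φ

  modalAt : World → Formula → Bool
  modalAt x ψ = neighbourhood x (_⊨ ψ)

  truthTable : ∀ d → Formula → Vec Bool (card d)
  truthTable d φ = map (λ μ → (d , μ) ⊨ φ) (allMinterms d)

  mutual
    mintermOf-world : ∀ d μ → mintermOf d (canonical (d , μ)) (modalAt (d , μ)) ≡ μ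
    mintermOf-world d (s , t) = cong₂ _,_
      (lookup-ext λ i → trans (lookup-map i _ variables)
                          (trans (cong (eval (valuation s) _) (lookup-variables i)) (valuation-toℕ s i)))
      (modalSigns-world d s t)

    modalSigns-world : ∀ d s t → map (eval (valuation s) (modalAt (d , s , t))) (factors d) ≡ t
    modalSigns-world zero    s [] = refl
    modalSigns-world (suc k) s t = lookup-ext λ j → begin
      lookup (map (eval (valuation s) (modalAt x)) (factors (suc k))) j
        ≡⟨ lookup-map j _ (factors (suc k)) ⟩
      eval (valuation s) (modalAt x) (lookup (factors (suc k)) j)
        ≡⟨ cong (eval (valuation s) (modalAt x)) (lookup-factors-lookup k j) ⟩
      modalAt x (dcf k (lookup (allVecs (card k)) j))
        ≡⟨ cong (lookup t ∘ rank) (truthTable-dcf k (lookup (allVecs (card k)) j)) ⟩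
      lookup t (rank (lookup (allVecs (card k)) j))
        ≡⟨ cong (lookup t) (rank-lookup {card k} j) ⟩
      lookup t j ∎
      where
      open ≡-Reasoning
      x = (suc k , s , t)

    truthTable-dcf : ∀ k S → truthTable k (dcf k S) ≡ S
    truthTable-dcf k S = lookup-ext λ i → let μ = lookup (allMinterms k) i in begin
      lookup (truthTable k (dcf k S)) i
        ≡⟨ lookup-map i _ (allMinterms k) ⟩
      (k , μ) ⊨ dcf k S
        ≡⟨ truth-eval canonical (k , μ) (dcf k S) ⟩
      eval (canonical (k , μ)) (modalAt (k , μ)) (dcf k S)
        ≡⟨ eval-dcf k S _ _ ⟩
      lookup S (rank² (mintermOf k (canonical (k , μ)) (modalAt (k , μ))))
        ≡⟨ cong (lookup S ∘ rank²) (mintermOf-world k μ) ⟩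
      lookup S (rank² μ)
        ≡⟨ cong (lookup S) (rank²-lookup {nf k} {v} i) ⟩
      lookup S i ∎
      where open ≡-Reasoning

  ⊨-minterm : ∀ d μ ν → (d , μ) ⊨ minterm d ν ≡ ν =ˢ μ
  ⊨-minterm d μ ν = begin
    (d , μ) ⊨ minterm d ν
      ≡⟨ truth-eval canonical (d , μ) (minterm d ν) ⟩
    eval (canonical (d , μ)) (modalAt (d , μ)) (minterm d ν)
      ≡⟨ eval-minterm d ν _ _ ⟩
    ν =ˢ mintermOf d (canonical (d , μ)) (modalAt (d , μ))
      ≡⟨ cong (ν =ˢ_) (mintermOf-world d μ) ⟩
    ν =ˢ μ ∎
    where open ≡-Reasoning

  eval-dcf-truthTable : ∀ d φ val w → eval val w (dcf d (truthTable d φ)) ≡ (d , mintermOf d val w) ⊨ φ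
  eval-dcf-truthTable d φ val w = begin
    eval val w (dcf d (truthTable d φ))                 ≡⟨ eval-dcf d (truthTable d φ) val w ⟩
    lookup (truthTable d φ) (rank² μ)                   ≡⟨ lookup-map (rank² μ) _ (allMinterms d) ⟩
    (d , lookup (allMinterms d) (rank² μ)) ⊨ φ          ≡⟨ cong (λ ν → (d , ν) ⊨ φ) (lookup-rank² μ) ⟩
    (d , μ) ⊨ φ                                         ∎
    where
    open ≡-Reasoning
    μ = mintermOf d val w

  ≈-dcf-truthTable : ∀ d φ → (∀ val w → eval val w ψ ≡ (d , mintermOf d val w) ⊨ φ) →
    ψ ≈ dcf d (truthTable d φ)
  ≈-dcf-truthTable d φ h = ≈-taut λ val w → trans (h val w) (sym (eval-dcf-truthTable d φ val w))

  dcf-normal-form : ∀ d φ → InF v d φ → φ ≈ dcf d (truthTable d φ)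
  dcf-normal-form d (var n) (n<v , _) = ≈-dcf-truthTable d (var n) λ val w → sym (begin
    valuation (map (eval val w) variables) n         ≡⟨ valuation-< _ n<v ⟩
    lookup (map (eval val w) variables) (fromℕ< n<v) ≡⟨ lookup-map (fromℕ< n<v) _ variables ⟩
    eval val w (lookup variables (fromℕ< n<v))       ≡⟨ cong (eval val w) (lookup-variables (fromℕ< n<v)) ⟩
    val (toℕ (fromℕ< n<v))                           ≡⟨ cong val (toℕ-fromℕ< n<v) ⟩
    val n                                            ∎)
    where open ≡-Reasoning
  dcf-normal-form d 𝟘 _ = ≈-dcf-truthTable d 𝟘 λ _ _ → refl
  dcf-normal-form d 𝟙 _ = ≈-dcf-truthTable d 𝟙 λ _ _ → refl
  dcf-normal-form d (¬' φ) p = ≈-trans (¬'-cong (dcf-normal-form d φ p))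
    (≈-dcf-truthTable d (¬' φ) λ val w → cong not (eval-dcf-truthTable d φ val w))
  dcf-normal-form d (φ ⋁ ψ) p = let pφ , pψ = InF-⋁⁻ φ ψ p in
    ≈-trans (⋁-cong (dcf-normal-form d φ pφ) (dcf-normal-form d ψ pψ))
      (≈-dcf-truthTable d (φ ⋁ ψ) λ val w → cong₂ _∨_ (eval-dcf-truthTable d φ val w) (eval-dcf-truthTable d ψ val w))
  dcf-normal-form d (φ ⋀ ψ) p = let pφ , pψ = InF-⋀⁻ φ ψ p in
    ≈-trans (⋀-cong (dcf-normal-form d φ pφ) (dcf-normal-form d ψ pψ))
      (≈-dcf-truthTable d (φ ⋀ ψ) λ val w → cong₂ _∧_ (eval-dcf-truthTable d φ val w) (eval-dcf-truthTable d ψ val w))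
  dcf-normal-form (suc k) (◇ φ) (p , s≤s q) = ≈-trans (re (dcf-normal-form k φ (p , q)))
    (≈-dcf-truthTable (suc k) (◇ φ) λ val w → sym (begin
      lookup (map (eval val w) (factors (suc k))) (rank (truthTable k φ))
        ≡⟨ lookup-map (rank (truthTable k φ)) _ (factors (suc k)) ⟩
      eval val w (lookup (factors (suc k)) (rank (truthTable k φ)))
        ≡⟨ cong (eval val w) (lookup-factors-rank k (truthTable k φ)) ⟩
      w (dcf k (truthTable k φ)) ∎))
    where open ≡-Reasoning

  truthTable-sound : φ ≈ ψ → truthTable d φ ≡ truthTable d ψ
  truthTable-sound {d = d} p = map-cong (λ μ → truth-cong p canonical (d , μ)) (allMinterms d)

  truthTable-complete : ∀ d φ ψ → InF v d φ → InF v d ψ → truthTable d φ ≡ truthTable d ψ → φ ≈ ψ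
  truthTable-complete d φ ψ p q e = begin
    φ                       ≈⟨ dcf-normal-form d φ p ⟩
    dcf d (truthTable d φ)  ≡⟨ cong (dcf d) e ⟩
    dcf d (truthTable d ψ)  ≈⟨ dcf-normal-form d ψ q ⟨
    ψ                       ∎
    where open ≈-Reasoning

  minterm-injective : ∀ d μ ν → minterm d μ ≈ minterm d ν → μ ≡ ν
  minterm-injective d μ ν p = =ˢ⇒≡ μ ν (begin
    μ =ˢ ν                  ≡⟨ ⊨-minterm d ν μ ⟨
    (d , ν) ⊨ minterm d μ   ≡⟨ truth-cong p canonical (d , ν) ⟩
    (d , ν) ⊨ minterm d ν   ≡⟨ ⊨-minterm d ν ν ⟩
    ν =ˢ ν                  ≡⟨ =ˢ-refl ν ⟩
    true                    ∎)
    where open ≡-Reasoning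

-- The action of a level-0 substitution on minterms

module Duality (v : ℕ) where
  open DCF v
  open NormalForms v

  -- σ sends the factor ◇ δ to ◇ (δ ∘ σ), which is ≈ the factor of the DCF formula with the
  -- truth table of δ ∘ σ.
  dualFactors : Sub0 v → ∀ d → Vec Bool (nf d) → Vec Bool (nf d)
  dualFactors σ zero    t = t
  dualFactors σ (suc k) t =
    tabulate λ j → lookup t (rank (truthTable k (dcf k (lookup (allVecs (card k)) j) ∘ₛ σ)))

  dual : Sub0 v → ∀ d → Minterm d → Minterm d
  dual σ d (s , t) = tabulate (λ i → (d , s , t) ⊨ proj₁ σ i) , dualFactors σ d t

  ⊨-dual : ∀ σ d φ → InF v d φ → ∀ μ → (d , dual σ d μ) ⊨ φ ≡ (d , μ) ⊨ φ ∘ₛ σ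
  ⊨-dual σ d (var n) (n<v , _) μ = begin
    valuation (proj₁ (dual σ d μ)) n                       ≡⟨ valuation-< _ n<v ⟩
    lookup (proj₁ (dual σ d μ)) (fromℕ< n<v)               ≡⟨ lookup∘tabulate _ (fromℕ< n<v) ⟩
    (d , μ) ⊨ proj₁ σ (fromℕ< n<v)                        ≡⟨ cong ((d , μ) ⊨_) (toSub-< σ n<v) ⟨
    (d , μ) ⊨ var n ∘ₛ σ                                   ∎
    where open ≡-Reasoning
  ⊨-dual σ d 𝟘 _ μ = refl
  ⊨-dual σ d 𝟙 _ μ = refl
  ⊨-dual σ d (¬' φ) p μ = cong not (⊨-dual σ d φ p μ)
  ⊨-dual σ d (φ ⋁ ψ) p μ = let pφ , pψ = InF-⋁⁻ φ ψ p in cong₂ _∨_ (⊨-dual σ d φ pφ μ) (⊨-dual σ d ψ pψ μ)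
  ⊨-dual σ d (φ ⋀ ψ) p μ = let pφ , pψ = InF-⋀⁻ φ ψ p in cong₂ _∧_ (⊨-dual σ d φ pφ μ) (⊨-dual σ d ψ pψ μ)
  ⊨-dual σ (suc k) (◇ φ) (p , s≤s q) (s , t) = begin
    lookup (dualFactors σ (suc k) t) (rank (truthTable k φ))
      ≡⟨ lookup∘tabulate _ (rank (truthTable k φ)) ⟩
    lookup t (rank (truthTable k (dcf k (lookup (allVecs (card k)) (rank (truthTable k φ))) ∘ₛ σ)))
      ≡⟨ cong (λ S → lookup t (rank (truthTable k (dcf k S ∘ₛ σ)))) (lookup-rank (truthTable k φ)) ⟩
    lookup t (rank (truthTable k (dcf k (truthTable k φ) ∘ₛ σ)))
      ≡⟨ cong (lookup t ∘ rank) (truthTable-sound {d = k} (usub (toSub σ) (dcf-normal-form k φ (p , q)))) ⟨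
    lookup t (rank (truthTable k (φ ∘ₛ σ))) ∎
    where open ≡-Reasoning

  dual-inverse : ∀ σ ρ → σ ⋅ ρ ≈id → ∀ d μ → dual σ d (dual ρ d μ) ≡ μ
  dual-inverse σ ρ σρ d μ = sym (=ˢ⇒≡ μ (dual σ d (dual ρ d μ)) (begin
    μ =ˢ dual σ d (dual ρ d μ)
      ≡⟨ ⊨-minterm d _ μ ⟨
    (d , dual σ d (dual ρ d μ)) ⊨ minterm d μ
      ≡⟨ ⊨-dual σ d (minterm d μ) (InF-minterm d μ) _ ⟩
    (d , dual ρ d μ) ⊨ minterm d μ ∘ₛ σ
      ≡⟨ ⊨-dual ρ d (minterm d μ ∘ₛ σ) (InF-∘ₛ σ (minterm d μ) (InF-minterm d μ)) μ ⟩
    (d , μ) ⊨ (minterm d μ ∘ₛ σ) ∘ₛ ρ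
      ≡⟨ truth-cong (∘ₛ-cancel σ ρ σρ (minterm d μ) (proj₁ (InF-minterm d μ))) canonical (d , μ) ⟩
    (d , μ) ⊨ minterm d μ
      ≡⟨ ⊨-minterm d μ μ ⟩
    μ =ˢ μ
      ≡⟨ =ˢ-refl μ ⟩
    true ∎))
    where open ≡-Reasoning

  minterm-∘ₛ : ∀ σ ρ → σ ⋅ ρ ≈id → ρ ⋅ σ ≈id → ∀ d μ → minterm d μ ∘ₛ σ ≈ minterm d (dual ρ d μ)
  minterm-∘ₛ σ ρ σρ ρσ d μ =
    truthTable-complete d _ _ (InF-∘ₛ σ (minterm d μ) (InF-minterm d μ)) (InF-minterm d (dual ρ d μ))
      (map-cong truthAt (allMinterms d))
    where
    open ≡-Reasoning
    truthAt : ∀ ν → (d , ν) ⊨ minterm d μ ∘ₛ σ ≡ (d , ν) ⊨ minterm d (dual ρ d μ)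
    truthAt ν = begin
      (d , ν) ⊨ minterm d μ ∘ₛ σ
        ≡⟨ ⊨-dual σ d (minterm d μ) (InF-minterm d μ) ν ⟨
      (d , dual σ d ν) ⊨ minterm d μ
        ≡⟨ ⊨-minterm d (dual σ d ν) μ ⟩
      μ =ˢ dual σ d ν
        ≡⟨ =ˢ-transpose {f = dual σ d} {g = dual ρ d} (dual-inverse σ ρ σρ d) (dual-inverse ρ σ ρσ d) μ ν ⟩
      dual ρ d μ =ˢ ν
        ≡⟨ ⊨-minterm d ν (dual ρ d μ) ⟨
      (d , ν) ⊨ minterm d (dual ρ d μ) ∎

theorem4 : (v : ℕ) (ς : Sub0 v) → IsPrime ς → (d : ℕ) →
    (Σ (DCF.Minterm v d → DCF.Minterm v d) λ f →
        (∀ μ → (DCF.minterm v d μ ∘ₛ ς) ≈ DCF.minterm v d (f μ))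
      × (∀ μ ν → (DCF.minterm v d μ ∘ₛ ς) ≈ DCF.minterm v d ν → ν ≡ f μ)
      × Bijective _≡_ _≡_ f)
    × IsLatticeAut v d (λ φ → φ ∘ₛ ς)
theorem4 v ς (τ , ςτ , τς) d =
  (dual τ d , minterm-∘ₛ ς τ ςτ τς d , unique , bijective) , ∘ₛ-isLatticeAut ς τ ςτ τς
  where
  open DCF v
  open NormalForms v
  open Duality v

  unique : ∀ μ ν → minterm d μ ∘ₛ ς ≈ minterm d ν → ν ≡ dual τ d μ
  unique μ ν p = minterm-injective d ν (dual τ d μ) (≈-trans (≈-sym p) (minterm-∘ₛ ς τ ςτ τς d μ))

  bijective : Bijective _≡_ _≡_ (dual τ d)
  bijective = Consequences≡.inverseᵇ⇒bijective {f⁻¹ = dual ς d}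
    ( Consequences≡.strictlyInverseˡ⇒inverseˡ (dual τ d) (dual-inverse τ ς τς d)
    , Consequences≡.strictlyInverseʳ⇒inverseʳ (dual τ d) (dual-inverse ς τ ςτ d) )
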